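{- For every connected graph $G$: (i) $\xi(G)\ge\beta(\widehat{G})$; (ii) $\Delta(G)\le\alpha(\widehat{G})$; (iii) $\omega(G)\le\alpha(\widehat{G})$ whenever $\mathrm{n}(G)\neq 2$.
   Context: All graphs are finite, simple and undirected; $\mathrm{n}(G)$ denotes the order of $G$, $\Delta(G)$ its maximum degree and $\omega(G)$ its clique number. For a connected graph $\Gamma$, a set $S\subseteq V(\Gamma)$ is a distance-equalizer set if for every two distinct $u,v\in V(\Gamma)\setminus S$ there is $w\in S$ with $d_\Gamma(w,u)=d_\Gamma(w,v)$; $\xi(\Gamma)$ is the minimum cardinality of such a set. The empty bisector graph $\widehat{G}$ has vertex set $V(G)$, with distinct $u,v$ adjacent iff there is no $w\in V(G)$ with $d_G(w,u)=d_G(w,v)$. $\alpha$ denotes the independence number and $\beta$ the vertex cover number. -}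

module Defs where

open import Data.Nat using (ℕ; zero; suc; _≤_)
open import Data.Fin using (Fin)
open import Data.Fin.Subset using (Subset; _∈_; _∉_; ∣_∣)
open import Data.Vec using (tabulate)
open import Data.Product using (Σ; ∃; ∃-syntax; _×_; _,_)
open import Data.Sum using (_⊎_)
open import Relation.Nullary using (¬_; does)
open import Relation.Binary.PropositionalEquality using (_≡_; _≢_)

record Graph (n : ℕ) : Set₁ where
  field
    Adj    : Fin n → Fin n → Set
    adj?   : (u v : Fin n) → Relation.Nullary.Dec (Adj u v)
    sym    : ∀ {u v} → Adj u v → Adj v u
    irrefl : ∀ {u} → ¬ Adj u u
open Graph public

VRel : ℕ → Set₁
VRel n = Fin n → Fin n → Set

module _ {n : ℕ} (G : Graph n) where

  data Walk : Fin n → Fin n → ℕ → Set where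
    nil  : ∀ {u} → Walk u u zero
    cons : ∀ {u v w k} → Adj G u v → Walk v w k → Walk u w (suc k)

  Connected : Set
  Connected = ∀ u v → ∃[ k ] Walk u v k

  Dist : Fin n → Fin n → ℕ → Set
  Dist u v k = Walk u v k × (∀ j → Walk u v j → k ≤ j)

  Equidistant : Fin n → Fin n → Fin n → Set
  Equidistant w u v = ∃[ k ] (Dist w u k × Dist w v k)

  IsDistanceEqualizer : Subset n → Set
  IsDistanceEqualizer S =
    ∀ u v → u ≢ v → u ∉ S → v ∉ S → ∃[ w ] (w ∈ S × Equidistant w u v)

  IsXi : ℕ → Set
  IsXi x = (∃[ S ] (IsDistanceEqualizer S × ∣ S ∣ ≡ x))
         × (∀ S → IsDistanceEqualizer S → x ≤ ∣ S ∣)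

  Hat : VRel n
  Hat u v = u ≢ v × ¬ (∃[ w ] Equidistant w u v)

  neighbours : Fin n → Subset n
  neighbours v = tabulate (λ u → does (adj? G v u))

  degree : Fin n → ℕ
  degree v = ∣ neighbours v ∣

  IsMaxDegree : ℕ → Set
  IsMaxDegree d = (∃[ v ] degree v ≡ d) × (∀ v → degree v ≤ d)

  IsClique : Subset n → Set
  IsClique S = ∀ u v → u ∈ S → v ∈ S → u ≢ v → Adj G u v

  IsCliqueNumber : ℕ → Set
  IsCliqueNumber c = (∃[ S ] (IsClique S × ∣ S ∣ ≡ c))
                   × (∀ S → IsClique S → ∣ S ∣ ≤ c)

module _ {n : ℕ} (E : VRel n) where

  IsIndependent : Subset n → Set
  IsIndependent S = ∀ u v → u ∈ S → v ∈ S → ¬ E u v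

  IsIndependenceNumber : ℕ → Set
  IsIndependenceNumber a = (∃[ S ] (IsIndependent S × ∣ S ∣ ≡ a))
                         × (∀ S → IsIndependent S → ∣ S ∣ ≤ a)

  IsVertexCover : Subset n → Set
  IsVertexCover S = ∀ u v → E u v → u ∈ S ⊎ v ∈ S

  IsVertexCoverNumber : ℕ → Set
  IsVertexCoverNumber b = (∃[ S ] (IsVertexCover S × ∣ S ∣ ≡ b))
                        × (∀ S → IsVertexCover S → b ≤ ∣ S ∣)

{-# OPTIONS --safe #-}
module Submission where

-- A vertex is equidistant from any two of its neighbours, so two vertices with a common
-- neighbour are never adjacent in Ĝ. Hence every neighbourhood of G is independent in Ĝ
-- (Δ ≤ α), and so is every clique with at least three vertices. A smaller clique is bounded
-- by α ≥ 2 as soon as some vertex has two neighbours; if none has, a connected G with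
-- n ≠ 2 has no edges, and its cliques are trivially Ĝ-independent. Finally a
-- distance-equalizer set must meet every edge of Ĝ, so β(Ĝ) ≤ ξ(G).

open import Defs renaming (sym to Adj-sym)
open import Data.Nat using (ℕ; zero; suc; _+_; _≤_; z≤n; s≤s; _≤?_)
open import Data.Nat.Properties using (≤-trans; ≤-reflexive; ≤-pred; ≰⇒>; ≤∧≢⇒<; +-suc; +-monoʳ-≤; module ≤-Reasoning)
open import Data.Product using (_×_; _,_; ∃-syntax; proj₂)
open import Data.Sum using (inj₁; inj₂)
open import Data.Fin using (_≟_)
open import Data.Fin.Properties using (any?)
open import Data.Fin.Subset using (Subset; _∈_; ∣_∣; _∪_; ⁅_⁆; ⊤; inside; outside)
open import Data.Fin.Subset.Properties
  using (_∈?_; ∈⊤; ∣⊤∣≡n; ∣⁅x⁆∣≡1; x∈⁅x⁆; x∈⁅y⁆⇒x≡y; p⊆q⇒∣p∣≤∣q∣; ∣p∣≤∣x∷p∣;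
         x∈p∪q⁺; x∈p∧x≢y⇒x∈p-y; x∈p⇒∣p-x∣<∣p∣)
open import Data.Vec using (_∷_; [])
open import Data.Vec.Properties using (lookup∘tabulate; []=⇒lookup; lookup⇒[]=)
open import Function using (_∘_)
open import Relation.Nullary using (¬_; Dec; yes; no; contradiction)
open import Relation.Nullary.Decidable using (¬?; _×-dec_; dec-true)
open import Relation.Binary.PropositionalEquality using (_≢_; refl; sym; trans; subst; cong₂)

∣p∪q∣≤∣p∣+∣q∣ : ∀ {n} (p q : Subset n) → ∣ p ∪ q ∣ ≤ ∣ p ∣ + ∣ q ∣
∣p∪q∣≤∣p∣+∣q∣ []            []            = z≤n
∣p∪q∣≤∣p∣+∣q∣ (outside ∷ p) (outside ∷ q) = ∣p∪q∣≤∣p∣+∣q∣ p q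
∣p∪q∣≤∣p∣+∣q∣ (outside ∷ p) (inside  ∷ q) =
  ≤-trans (s≤s (∣p∪q∣≤∣p∣+∣q∣ p q)) (≤-reflexive (sym (+-suc ∣ p ∣ ∣ q ∣)))
∣p∪q∣≤∣p∣+∣q∣ (inside  ∷ p) (t       ∷ q) =
  s≤s (≤-trans (∣p∪q∣≤∣p∣+∣q∣ p q) (+-monoʳ-≤ ∣ p ∣ (∣p∣≤∣x∷p∣ t q)))

x∈p⇒1≤∣p∣ : ∀ {n x} {p : Subset n} → x ∈ p → 1 ≤ ∣ p ∣
x∈p⇒1≤∣p∣ {x = x} {p} x∈p = subst (_≤ ∣ p ∣) (∣⁅x⁆∣≡1 x) (p⊆q⇒∣p∣≤∣q∣ ⁅x⁆⊆p)
  where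
  ⁅x⁆⊆p : ∀ {y} → y ∈ ⁅ x ⁆ → y ∈ p
  ⁅x⁆⊆p y∈⁅x⁆ = subst (_∈ p) (sym (x∈⁅y⁆⇒x≡y x y∈⁅x⁆)) x∈p

x∈p∧y∈p∧x≢y⇒2≤∣p∣ : ∀ {n x y} {p : Subset n} → x ∈ p → y ∈ p → x ≢ y → 2 ≤ ∣ p ∣
x∈p∧y∈p∧x≢y⇒2≤∣p∣ x∈p y∈p x≢y =
  ≤-trans (s≤s (x∈p⇒1≤∣p∣ (x∈p∧x≢y⇒x∈p-y y∈p (x≢y ∘ sym)))) (x∈p⇒∣p-x∣<∣p∣ x∈p)

3≤∣p∣⇒∃-third-member : ∀ {n} {p : Subset n} → 3 ≤ ∣ p ∣ → ∀ x y → ∃[ z ] (z ∈ p × z ≢ x × z ≢ y)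
3≤∣p∣⇒∃-third-member {p = p} 3≤∣p∣ x y
  with any? (λ z → z ∈? p ×-dec (¬? (z ≟ x) ×-dec ¬? (z ≟ y)))
... | yes third = third
... | no ¬third = contradiction (≤-trans 3≤∣p∣ ∣p∣≤2) λ { (s≤s (s≤s ())) }
  where
  p⊆⁅x⁆∪⁅y⁆ : ∀ {z} → z ∈ p → z ∈ ⁅ x ⁆ ∪ ⁅ y ⁆
  p⊆⁅x⁆∪⁅y⁆ {z} z∈p with z ≟ x | z ≟ y
  ... | yes refl | _        = x∈p∪q⁺ (inj₁ (x∈⁅x⁆ z))
  ... | no _     | yes refl = x∈p∪q⁺ (inj₂ (x∈⁅x⁆ z))
  ... | no z≢x   | no z≢y   = contradiction (z , z∈p , z≢x , z≢y) ¬third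

  ∣p∣≤2 : ∣ p ∣ ≤ 2
  ∣p∣≤2 = begin
    ∣ p ∣                     ≤⟨ p⊆q⇒∣p∣≤∣q∣ p⊆⁅x⁆∪⁅y⁆ ⟩
    ∣ ⁅ x ⁆ ∪ ⁅ y ⁆ ∣         ≤⟨ ∣p∪q∣≤∣p∣+∣q∣ ⁅ x ⁆ ⁅ y ⁆ ⟩
    ∣ ⁅ x ⁆ ∣ + ∣ ⁅ y ⁆ ∣     ≡⟨ cong₂ _+_ (∣⁅x⁆∣≡1 x) (∣⁅x⁆∣≡1 y) ⟩
    2                         ∎
    where open ≤-Reasoning

module _ {n : ℕ} (G : Graph n) where

  Cherry : Set
  Cherry = ∃[ c ] ∃[ a ] ∃[ b ] (a ≢ b × Adj G c a × Adj G c b)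

  cherry? : Dec Cherry
  cherry? = any? λ c → any? λ a → any? λ b →
    ¬? (a ≟ b) ×-dec (adj? G c a ×-dec adj? G c b)

  ∈-neighbours⁻ : ∀ {u v} → u ∈ neighbours G v → Adj G v u
  ∈-neighbours⁻ {u} {v} u∈N
    with adj? G v u | trans (sym (lookup∘tabulate _ u)) ([]=⇒lookup u∈N)
  ... | yes vu | _  = vu
  ... | no _   | ()

  ∈-neighbours⁺ : ∀ {u v} → Adj G v u → u ∈ neighbours G v
  ∈-neighbours⁺ {u} {v} vu =
    lookup⇒[]= u _ (trans (lookup∘tabulate _ u) (dec-true (adj? G v u) vu))

  Adj⇒Dist1 : ∀ {u v} → Adj G u v → Dist G u v 1
  Adj⇒Dist1 {u} {v} uv = cons uv nil , shortest
    where
    shortest : ∀ j → Walk G u v j → 1 ≤ j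
    shortest zero    nil = contradiction uv (irrefl G)
    shortest (suc j) _   = s≤s z≤n

  common-neighbour⇒¬Hat : ∀ {w u v} → Adj G w u → Adj G w v → ¬ Hat G u v
  common-neighbour⇒¬Hat wu wv (_ , ¬equidistant) =
    ¬equidistant (_ , 1 , Adj⇒Dist1 wu , Adj⇒Dist1 wv)

  neighbours-independent : ∀ v → IsIndependent (Hat G) (neighbours G v)
  neighbours-independent v u w u∈N w∈N =
    common-neighbour⇒¬Hat (∈-neighbours⁻ u∈N) (∈-neighbours⁻ w∈N)

  clique-independent : ∀ {K} → IsClique G K → 3 ≤ ∣ K ∣ → IsIndependent (Hat G) K
  clique-independent K-clique 3≤∣K∣ u v u∈K v∈K with 3≤∣p∣⇒∃-third-member 3≤∣K∣ u v
  ... | w , w∈K , w≢u , w≢v =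
    common-neighbour⇒¬Hat (K-clique w u w∈K u∈K w≢u) (K-clique w v w∈K v∈K w≢v)

  -- The first vertex of the walk lying in {u, v} is the centre of a cherry: its neighbours
  -- are its predecessor on the walk and the other end of the edge.
  walk-into-edge⇒cherry : ∀ {u v x k} → Adj G u v → x ≢ u → x ≢ v → Walk G x u k → Cherry
  walk-into-edge⇒cherry uv x≢u x≢v nil = contradiction refl x≢u
  walk-into-edge⇒cherry {u} {v} {x} uv x≢u x≢v (cons {v = y} xy walk) with y ≟ u | y ≟ v
  ... | yes refl | _        = u , x , v , x≢v , Adj-sym G xy , uv
  ... | no _     | yes refl = v , x , u , x≢u , Adj-sym G xy , Adj-sym G uv
  ... | no y≢u   | no y≢v   = walk-into-edge⇒cherry uv y≢u y≢v walk

  edge⇒cherry : Connected G → n ≢ 2 → ∀ {u v} → Adj G u v → Cherry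
  edge⇒cherry connected n≢2 {u} {v} uv =
    let w , _ , w≢u , w≢v = 3≤∣p∣⇒∃-third-member {p = ⊤} 3≤∣⊤∣ u v
    in  walk-into-edge⇒cherry uv w≢u w≢v (proj₂ (connected w u))
    where
    2≤∣⊤∣ : 2 ≤ ∣ ⊤ {n} ∣
    2≤∣⊤∣ = x∈p∧y∈p∧x≢y⇒2≤∣p∣ (∈⊤ {x = u}) (∈⊤ {x = v}) λ { refl → irrefl G uv }

    3≤∣⊤∣ : 3 ≤ ∣ ⊤ {n} ∣
    3≤∣⊤∣ = ≤∧≢⇒< 2≤∣⊤∣ (n≢2 ∘ trans (sym (∣⊤∣≡n n)) ∘ sym)

  distance-equalizer⇒vertex-cover : ∀ {S} → IsDistanceEqualizer G S → IsVertexCover (Hat G) S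
  distance-equalizer⇒vertex-cover {S} equalizer u v (u≢v , ¬equidistant) with u ∈? S | v ∈? S
  ... | yes u∈S | _       = inj₁ u∈S
  ... | no _    | yes v∈S = inj₂ v∈S
  ... | no u∉S  | no v∉S  with equalizer u v u≢v u∉S v∉S
  ...   | w , _ , equidistant = contradiction (w , equidistant) ¬equidistant

  module _ {a : ℕ} (α : IsIndependenceNumber (Hat G) a) where

    degree≤α : ∀ v → degree G v ≤ a
    degree≤α v = proj₂ α (neighbours G v) (neighbours-independent v)

    cherry⇒2≤α : Cherry → 2 ≤ a
    cherry⇒2≤α (c , x , y , x≢y , cx , cy) =
      ≤-trans (x∈p∧y∈p∧x≢y⇒2≤∣p∣ (∈-neighbours⁺ cx) (∈-neighbours⁺ cy) x≢y) (degree≤α c)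

    clique≤α : Connected G → n ≢ 2 → ∀ {K} → IsClique G K → ∣ K ∣ ≤ a
    clique≤α connected n≢2 {K} K-clique with cherry? | 3 ≤? ∣ K ∣
    ... | yes _      | yes 3≤∣K∣ = proj₂ α K (clique-independent K-clique 3≤∣K∣)
    ... | yes cherry | no 3≰∣K∣  = ≤-trans (≤-pred (≰⇒> 3≰∣K∣)) (cherry⇒2≤α cherry)
    ... | no ¬cherry | _ = proj₂ α K λ u v u∈K v∈K (u≢v , _) →
      ¬cherry (edge⇒cherry connected n≢2 (K-clique u v u∈K v∈K u≢v))

proposition32 : ∀ {n : ℕ} (G : Graph n) → Connected G →
    (∀ x b → IsXi G x → IsVertexCoverNumber (Hat G) b → b ≤ x)
    × (∀ d a → IsMaxDegree G d → IsIndependenceNumber (Hat G) a → d ≤ a)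
    × (n ≢ 2 → ∀ c a → IsCliqueNumber G c → IsIndependenceNumber (Hat G) a → c ≤ a)
proposition32 {n} G connected = β≤ξ , Δ≤α , ω≤α
  where
  β≤ξ : ∀ x b → IsXi G x → IsVertexCoverNumber (Hat G) b → b ≤ x
  β≤ξ x b ((S , equalizer , ∣S∣≡x) , _) (_ , minimal) =
    subst (b ≤_) ∣S∣≡x (minimal S (distance-equalizer⇒vertex-cover G equalizer))

  Δ≤α : ∀ d a → IsMaxDegree G d → IsIndependenceNumber (Hat G) a → d ≤ a
  Δ≤α d a ((v , degree≡d) , _) α = subst (_≤ a) degree≡d (degree≤α G α v)

  ω≤α : n ≢ 2 → ∀ c a → IsCliqueNumber G c → IsIndependenceNumber (Hat G) a → c ≤ a
  ω≤α n≢2 c a ((K , K-clique , ∣K∣≡c) , _) α =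
    subst (_≤ a) ∣K∣≡c (clique≤α G α connected n≢2 K-clique)
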